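{- Let $m$ be an odd integer and let $u$ be an odd integer with $\phi(u)=4m$. Then either $u=\frac{(2z_1+1)(2z_2+1)}{z_1z_2}m$ for some positive integers $z_1\ne z_2$ with $z_1z_2\mid m$ and $2z_1+1,2z_2+1$ prime, or $u=\frac{4z_3+1}{z_3}m$ for some positive integer $z_3$ with $z_3\mid m$ and $4z_3+1$ prime. Moreover $4m<u\le 7m$.
   Context: $\phi$ denotes Euler's totient function. -}

module Defs where

open import Data.Nat using (ℕ; suc; _≟_; _%_)
open import Relation.Binary.PropositionalEquality using (_≡_)
open import Data.Nat.GCD using (gcd)
open import Data.List using (List; length; filter; upTo; map)
open import Relation.Nullary.Decidable using (Dec)

range1 : ℕ → List ℕ
range1 n = map suc (upTo n)

φ : ℕ → ℕ
φ n = length (filter (λ k → gcd k n ≟ 1) (range1 n))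

Odd : ℕ → Set
Odd n = n % 2 ≡ 1

{-# OPTIONS --safe #-}
module Submission where

-- Write u = p^(a+1) r with p = 2e+1 an odd prime not dividing r, so that φ u = p^a · 2e · φ r = 4m.
-- If r = 1, then e is even because m is odd; with e = 2z this gives m = z p^a and u = (4z+1) m / z.
-- Otherwise split r = q^(b+1) s in the same way, with q = 2f+1; then φ u = 4 p^a q^b e f φ s, and as
-- φ s is even for odd s > 1 while m is odd, s = 1, m = e f p^a q^b and u = (2e+1)(2f+1) m / (e f).
-- The bounds come from u / m = 4 + 1/z and u / m = (2 + 1/e)(2 + 1/f) with e ≠ f odd.
-- The formula for φ (p^(a+1) r) is proved by counting: the k < p^(a+1) r coprime to r are those
-- coprime to p^(a+1) r together with the multiples j p with j coprime to r.

open import Defs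
open import Data.Bool using (true; false; if_then_else_)
open import Data.Empty using (⊥-elim)
open import Data.List using (length; filter; applyUpTo; []; _∷_)
open import Data.List.Properties using (map-upTo)
open import Data.List.Relation.Unary.All using (_∷_)
open import Data.Nat
open import Data.Nat.Coprimality using (Coprime; coprime?; coprime-+; coprime-divisor)
open import Data.Nat.Divisibility
open import Data.Nat.GCD using (gcd)
open import Data.Nat.Induction using (<-rec)
open import Data.Nat.Primality
  using (Prime; prime⇒irreducible; prime⇒nonZero; prime⇒nonTrivial; ¬prime[1]; euclidsLemma; prime[2])
open import Data.Nat.Primality.Factorisation using (factorise)
open import Data.Nat.Properties
open import Algebra.Properties.CommutativeSemigroup +-commutativeSemigroup using (interchange)
open import Algebra.Properties.CommutativeSemigroup *-commutativeSemigroup using (x∙yz≈y∙xz; xy∙z≈xz∙y)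
open import Data.Nat.Tactic.RingSolver using (solve-∀)
open import Data.Product using (Σ; ∃-syntax; _×_; _,_)
open import Data.Sum using (_⊎_; inj₁; inj₂)
open import Function using (_∘_; _⇔_; mk⇔)
open import Relation.Nullary using (Dec; yes; no; does; ¬_)
open import Relation.Nullary.Decidable using (dec-false; dec-true; does-⇔)
open import Relation.Binary.PropositionalEquality

∑< : ℕ → (ℕ → ℕ) → ℕ
∑< zero    f = 0
∑< (suc n) f = f 0 + ∑< n (f ∘ suc)

syntax ∑< n (λ k → e) = ∑[ k < n ] e

∑-cong : ∀ n {f g : ℕ → ℕ} → (∀ k → k < n → f k ≡ g k) → ∑< n f ≡ ∑< n g
∑-cong zero    f≗g = refl
∑-cong (suc n) f≗g = cong₂ _+_ (f≗g 0 z<s) (∑-cong n (λ k k<n → f≗g (suc k) (s<s k<n)))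

∑-zero : ∀ n {f : ℕ → ℕ} → (∀ k → k < n → f k ≡ 0) → ∑< n f ≡ 0
∑-zero zero    f≗0 = refl
∑-zero (suc n) f≗0 = cong₂ _+_ (f≗0 0 z<s) (∑-zero n (λ k k<n → f≗0 (suc k) (s<s k<n)))

∑-split : ∀ m n (f : ℕ → ℕ) → ∑< (m + n) f ≡ ∑< m f + ∑[ k < n ] f (m + k)
∑-split zero    n f = refl
∑-split (suc m) n f = trans (cong (f 0 +_) (∑-split m n (f ∘ suc))) (sym (+-assoc (f 0) _ _))

∑-distrib-+ : ∀ n (f g : ℕ → ℕ) → ∑[ k < n ] (f k + g k) ≡ ∑< n f + ∑< n g
∑-distrib-+ zero    f g = refl
∑-distrib-+ (suc n) f g = begin
  f 0 + g 0 + ∑[ k < n ] (f (suc k) + g (suc k))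
    ≡⟨ cong (f 0 + g 0 +_) (∑-distrib-+ n (f ∘ suc) (g ∘ suc)) ⟩
  f 0 + g 0 + (∑< n (f ∘ suc) + ∑< n (g ∘ suc))
    ≡⟨ interchange (f 0) (g 0) (∑< n (f ∘ suc)) (∑< n (g ∘ suc)) ⟩
  f 0 + ∑< n (f ∘ suc) + (g 0 + ∑< n (g ∘ suc)) ∎
  where open ≡-Reasoning

∑-periodic : ∀ c r (f : ℕ → ℕ) → (∀ k → f (r + k) ≡ f k) → ∑< (c * r) f ≡ c * ∑< r f
∑-periodic zero    r f per = refl
∑-periodic (suc c) r f per = begin
  ∑< (r + c * r) f                   ≡⟨ ∑-split r (c * r) f ⟩
  ∑< r f + ∑[ k < c * r ] f (r + k)  ≡⟨ cong (∑< r f +_) (∑-cong (c * r) (λ k _ → per k)) ⟩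
  ∑< r f + ∑< (c * r) f              ≡⟨ cong (∑< r f +_) (∑-periodic c r f per) ⟩
  ∑< r f + c * ∑< r f                ∎
  where open ≡-Reasoning

∑-snoc : ∀ n (f : ℕ → ℕ) → ∑< (suc n) f ≡ ∑< n f + f n
∑-snoc zero    f = +-comm (f 0) 0
∑-snoc (suc n) f = trans (cong (f 0 +_) (∑-snoc n (f ∘ suc))) (sym (+-assoc (f 0) _ _))

∑-rotate : ∀ n (f : ℕ → ℕ) → f 0 ≡ f n → ∑[ k < n ] f (suc k) ≡ ∑< n f
∑-rotate n f f0≡fn = +-cancelˡ-≡ (f n) _ _ (begin
  f n + ∑< n (f ∘ suc)  ≡⟨ cong (_+ ∑< n (f ∘ suc)) (sym f0≡fn) ⟩
  ∑< (suc n) f          ≡⟨ ∑-snoc n f ⟩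
  ∑< n f + f n          ≡⟨ +-comm (∑< n f) (f n) ⟩
  f n + ∑< n f          ∎)
  where open ≡-Reasoning

when : {A : Set} → Dec A → ℕ → ℕ
when a? x = if does a? then x else 0

when-⇔ : ∀ {A B : Set} {x} → A ⇔ B → (a? : Dec A) (b? : Dec B) → when a? x ≡ when b? x
when-⇔ A⇔B a? b? = cong (λ b → if b then _ else 0) (does-⇔ A⇔B a? b?)

when-yes : ∀ {A : Set} {x} → A → (a? : Dec A) → when a? x ≡ x
when-yes a a? rewrite dec-true a? a = refl

when-no : ∀ {A : Set} {x} → ¬ A → (a? : Dec A) → when a? x ≡ 0
when-no ¬a a? rewrite dec-false a? ¬a = refl

length-filter-applyUpTo : ∀ {P : ℕ → Set} (P? : ∀ k → Dec (P k)) (g : ℕ → ℕ) n →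
  length (filter P? (applyUpTo g n)) ≡ ∑[ k < n ] when (P? (g k)) 1
length-filter-applyUpTo P? g zero = refl
length-filter-applyUpTo P? g (suc n) with does (P? (g 0))
... | true  = cong suc (length-filter-applyUpTo P? (g ∘ suc) n)
... | false = length-filter-applyUpTo P? (g ∘ suc) n

∑-multiples : ∀ p n (f : ℕ → ℕ) → .{{NonZero p}} →
  ∑[ k < n * p ] when (p ∣? k) (f k) ≡ ∑[ j < n ] f (j * p)
∑-multiples p zero    f = refl
∑-multiples p@(suc p₀) (suc n) f = begin
  ∑[ k < p + n * p ] when (p ∣? k) (f k)
    ≡⟨ ∑-split p (n * p) (λ k → when (p ∣? k) (f k)) ⟩
  ∑[ k < p ] when (p ∣? k) (f k) + ∑[ k < n * p ] when (p ∣? (p + k)) (f (p + k))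
    ≡⟨ cong₂ _+_ firstBlock (∑-cong (n * p) (λ k _ → when-⇔ p∣p+k⇔p∣k (p ∣? (p + k)) (p ∣? k))) ⟩
  f 0 + ∑[ k < n * p ] when (p ∣? k) (f (p + k))
    ≡⟨ cong (f 0 +_) (∑-multiples p n (f ∘ (p +_))) ⟩
  f 0 + ∑[ j < n ] f (p + j * p) ∎
  where
  open ≡-Reasoning
  p∣p+k⇔p∣k : ∀ {k} → p ∣ p + k ⇔ p ∣ k
  p∣p+k⇔p∣k = mk⇔ (λ p∣p+k → ∣m+n∣m⇒∣n p∣p+k ∣-refl) (∣m∣n⇒∣m+n ∣-refl)
  firstBlock : ∑[ k < p ] when (p ∣? k) (f k) ≡ f 0
  firstBlock = trans (cong₂ _+_ (when-yes (p ∣0) (p ∣? 0))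
    (∑-zero p₀ (λ i i<p₀ → when-no (λ p∣1+i → <⇒≱ (s<s i<p₀) (∣⇒≤ p∣1+i)) (p ∣? suc i))))
    (+-identityʳ (f 0))

[_⊥_] : ℕ → ℕ → ℕ
[ k ⊥ n ] = when (coprime? k n) 1

[⊥]-⇔ : ∀ {k n k₁ n₁} → Coprime k n ⇔ Coprime k₁ n₁ → [ k ⊥ n ] ≡ [ k₁ ⊥ n₁ ]
[⊥]-⇔ {k} {n} {k₁} {n₁} iff = when-⇔ iff (coprime? k n) (coprime? k₁ n₁)

-- φ counts over 1, …, n; shifting to 0, …, n - 1 is harmless since 0 and n have the same
-- common divisors with n.
φ≡∑[⊥] : ∀ n → φ n ≡ ∑[ k < n ] [ k ⊥ n ]
φ≡∑[⊥] n = begin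
  φ n
    ≡⟨ cong (length ∘ filter (λ k → gcd k n ≟ 1)) (map-upTo suc n) ⟩
  length (filter (λ k → gcd k n ≟ 1) (applyUpTo suc n))
    ≡⟨ length-filter-applyUpTo (λ k → gcd k n ≟ 1) suc n ⟩
  ∑[ k < n ] [ suc k ⊥ n ]
    ≡⟨ ∑-rotate n [_⊥ n ] ([⊥]-⇔ 0⊥n⇔n⊥n) ⟩
  ∑[ k < n ] [ k ⊥ n ] ∎
  where
  open ≡-Reasoning
  0⊥n⇔n⊥n : Coprime 0 n ⇔ Coprime n n
  0⊥n⇔n⊥n = mk⇔ (λ 0⊥n {_} (_ , d∣n) → 0⊥n (_ ∣0 , d∣n))
                 (λ n⊥n {_} (_ , d∣n) → n⊥n (d∣n , d∣n))

∑[⊥]-periodic : ∀ c r → ∑[ k < c * r ] [ k ⊥ r ] ≡ c * φ r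
∑[⊥]-periodic c r = begin
  ∑[ k < c * r ] [ k ⊥ r ] ≡⟨ ∑-periodic c r [_⊥ r ] (λ k → [⊥]-⇔ r+k⊥r⇔k⊥r) ⟩
  c * ∑[ k < r ] [ k ⊥ r ] ≡⟨ cong (c *_) (sym (φ≡∑[⊥] r)) ⟩
  c * φ r                  ∎
  where
  open ≡-Reasoning
  r+k⊥r⇔k⊥r : ∀ {k} → Coprime (r + k) r ⇔ Coprime k r
  r+k⊥r⇔k⊥r = mk⇔ (λ r+k⊥r {_} (d∣k , d∣r) → r+k⊥r (∣m∣n⇒∣m+n d∣r d∣k , d∣r)) coprime-+

coprime-* : ∀ {k m n} → Coprime k m → Coprime k n → Coprime k (m * n)
coprime-* {m = m} k⊥m k⊥n {d} (d∣k , d∣mn) = k⊥n (d∣k , coprime-divisor d⊥m d∣mn)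
  where
  d⊥m : Coprime d m
  d⊥m (e∣d , e∣m) = k⊥m (∣-trans e∣d d∣k , e∣m)

coprime-^ : ∀ {k m} a → Coprime k m → Coprime k (m ^ a)
coprime-^ zero    k⊥m (_ , d∣1) = ∣1⇒≡1 d∣1
coprime-^ (suc a) k⊥m = coprime-* k⊥m (coprime-^ a k⊥m)

coprime-∣ : ∀ {d n m} → d ∣ n → Coprime n m → Coprime d m
coprime-∣ d∣n n⊥m (e∣d , e∣m) = n⊥m (∣-trans e∣d d∣n , e∣m)

prime∤⇒coprime : ∀ {p n} → Prime p → ¬ p ∣ n → Coprime n p
prime∤⇒coprime p-prime p∤n (d∣n , d∣p) with prime⇒irreducible p-prime d∣p
... | inj₁ d≡1 = d≡1
... | inj₂ refl = ⊥-elim (p∤n d∣n)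

module _ {p r : ℕ} (a : ℕ) (p-prime : Prime p) (p∤r : ¬ p ∣ r) where
  private
    instance
      p≢0 : NonZero p
      p≢0 = prime⇒nonZero p-prime

    N : ℕ
    N = p ^ suc a * r

    k*p⊥r⇔k⊥r : ∀ {k} → Coprime (k * p) r ⇔ Coprime k r
    k*p⊥r⇔k⊥r {k} = mk⇔
      (λ kp⊥r {_} (d∣k , d∣r) → kp⊥r (∣m⇒∣m*n p d∣k , d∣r))
      (λ k⊥r {d} (d∣kp , d∣r) → k⊥r (coprime-divisor (coprime-∣ d∣r (prime∤⇒coprime p-prime p∤r))
                                                     (subst (d ∣_) (*-comm k p) d∣kp) , d∣r))

    [⊥r]-split : ∀ k → [ k ⊥ r ] ≡ [ k ⊥ N ] + when (p ∣? k) [ k ⊥ r ]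
    [⊥r]-split k with p ∣? k
    ... | yes p∣k = cong (_+ [ k ⊥ r ]) (sym (when-no k⊥̸N (coprime? k N)))
      where
      k⊥̸N : ¬ Coprime k N
      k⊥̸N k⊥N = ¬prime[1] (subst Prime (k⊥N (p∣k , ∣m⇒∣m*n r (∣m⇒∣m*n (p ^ a) ∣-refl))) p-prime)
    ... | no p∤k = trans ([⊥]-⇔ k⊥r⇔k⊥N) (sym (+-identityʳ _))
      where
      k⊥p = prime∤⇒coprime p-prime p∤k
      k⊥r⇔k⊥N : Coprime k r ⇔ Coprime k N
      k⊥r⇔k⊥N = mk⇔ (coprime-* (coprime-^ (suc a) k⊥p))
                    (λ k⊥N {_} (d∣k , d∣r) → k⊥N (d∣k , ∣n⇒∣m*n (p ^ suc a) d∣r))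

    ∑-multiples-[⊥r] : ∑[ k < N ] when (p ∣? k) [ k ⊥ r ] ≡ p ^ a * φ r
    ∑-multiples-[⊥r] = begin
      ∑[ k < N ] when (p ∣? k) [ k ⊥ r ]             ≡⟨ cong (λ n → ∑[ k < n ] when (p ∣? k) [ k ⊥ r ]) N≡ ⟩
      ∑[ k < p ^ a * r * p ] when (p ∣? k) [ k ⊥ r ] ≡⟨ ∑-multiples p (p ^ a * r) [_⊥ r ] ⟩
      ∑[ j < p ^ a * r ] [ j * p ⊥ r ]               ≡⟨ ∑-cong (p ^ a * r) (λ j _ → [⊥]-⇔ (k*p⊥r⇔k⊥r {j})) ⟩
      ∑[ j < p ^ a * r ] [ j ⊥ r ]                   ≡⟨ ∑[⊥]-periodic (p ^ a) r ⟩
      p ^ a * φ r                                    ∎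
      where
      open ≡-Reasoning
      N≡ : N ≡ p ^ a * r * p
      N≡ = trans (cong (_* r) (*-comm p (p ^ a))) (xy∙z≈xz∙y (p ^ a) p r)

  φ-prime-power-+ : φ (p ^ suc a * r) + p ^ a * φ r ≡ p ^ suc a * φ r
  φ-prime-power-+ = begin
    φ N + p ^ a * φ r                                         ≡⟨ cong₂ _+_ (φ≡∑[⊥] N) (sym ∑-multiples-[⊥r]) ⟩
    ∑[ k < N ] [ k ⊥ N ] + ∑[ k < N ] when (p ∣? k) [ k ⊥ r ] ≡⟨ sym (∑-distrib-+ N _ _) ⟩
    ∑[ k < N ] ([ k ⊥ N ] + when (p ∣? k) [ k ⊥ r ])          ≡⟨ sym (∑-cong N (λ k _ → [⊥r]-split k)) ⟩
    ∑[ k < N ] [ k ⊥ r ]                                      ≡⟨ ∑[⊥]-periodic (p ^ suc a) r ⟩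
    p ^ suc a * φ r                                           ∎
    where open ≡-Reasoning

  φ-prime-power : φ (p ^ suc a * r) ≡ p ^ a * (p ∸ 1) * φ r
  φ-prime-power = begin
    φ N                   ≡⟨ sym (m+n∸n≡m (φ N) X) ⟩
    φ N + X ∸ X           ≡⟨ cong (_∸ X) φ-prime-power-+ ⟩
    p ^ suc a * φ r ∸ X   ≡⟨ cong (_∸ X) (*-assoc p (p ^ a) (φ r)) ⟩
    p * X ∸ X             ≡⟨ cong (p * X ∸_) (sym (*-identityˡ X)) ⟩
    p * X ∸ 1 * X         ≡⟨ sym (*-distribʳ-∸ X p 1) ⟩
    (p ∸ 1) * X           ≡⟨ sym (*-assoc (p ∸ 1) (p ^ a) (φ r)) ⟩
    (p ∸ 1) * p ^ a * φ r ≡⟨ cong (_* φ r) (*-comm (p ∸ 1) (p ^ a)) ⟩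
    p ^ a * (p ∸ 1) * φ r ∎
    where
    open ≡-Reasoning
    X = p ^ a * φ r

factorOut : ∀ p .{{_ : NonTrivial p}} n → .{{NonZero n}} → ∃[ a ] ∃[ r ] n ≡ p ^ a * r × ¬ p ∣ r
factorOut p = <-rec _ go
  where
  go : ∀ n → (∀ {m} → m < n → .{{NonZero m}} → ∃[ a ] ∃[ r ] m ≡ p ^ a * r × ¬ p ∣ r) →
       .{{NonZero n}} → ∃[ a ] ∃[ r ] n ≡ p ^ a * r × ¬ p ∣ r
  go n rec with p ∣? n
  ... | no p∤n = 0 , n , sym (+-identityʳ n) , p∤n
  ... | yes p∣n with rec (quotient-< p∣n) {{quotient≢0 p∣n}}
  ...   | a , r , q≡pᵃr , p∤r = suc a , r , n≡ , p∤r
    where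
    n≡ : n ≡ p ^ suc a * r
    n≡ = begin
      n                 ≡⟨ m∣n⇒n≡m*quotient p∣n ⟩
      p * quotient p∣n  ≡⟨ cong (p *_) q≡pᵃr ⟩
      p * (p ^ a * r)   ≡⟨ sym (*-assoc p (p ^ a) r) ⟩
      p ^ suc a * r     ∎
      where open ≡-Reasoning

primeDivisor : ∀ {n} → 1 < n → ∃[ p ] Prime p × p ∣ n
primeDivisor {n} 1<n with factorise n {{>-nonZero (<-trans z<s 1<n)}}
... | record { factors = [] ; isFactorisation = n≡1 } = ⊥-elim (<⇒≢ 1<n (sym n≡1))
... | record { factors = p ∷ _ ; isFactorisation = n≡∏ ; factorsPrime = p-prime ∷ _ } =
  p , p-prime , subst (p ∣_) (sym n≡∏) (m∣m*n _)

primePowerSplit : ∀ {n} → 1 < n → ∃[ p ] ∃[ a ] ∃[ r ] Prime p × ¬ p ∣ r × n ≡ p ^ suc a * r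
primePowerSplit {n} 1<n with primeDivisor 1<n
... | p , p-prime , p∣n
    with factorOut p {{prime⇒nonTrivial p-prime}} n {{>-nonZero (<-trans z<s 1<n)}}
...   | zero  , r , n≡r , p∤r = ⊥-elim (p∤r (subst (p ∣_) (trans n≡r (+-identityʳ r)) p∣n))
...   | suc a , r , n≡  , p∤r = p , a , r , p-prime , p∤r , n≡

odd⇒¬2∣ : ∀ {n} → Odd n → ¬ 2 ∣ n
odd⇒¬2∣ {n} n%2≡1 2∣n with trans (sym n%2≡1) (n∣m⇒m%n≡0 n 2 2∣n)
... | ()

¬2∣⇒≡2*+1 : ∀ n → ¬ 2 ∣ n → ∃[ e ] n ≡ 2 * e + 1
¬2∣⇒≡2*+1 zero          2∤0   = ⊥-elim (2∤0 (2 ∣0))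
¬2∣⇒≡2*+1 (suc zero)    _     = 0 , refl
¬2∣⇒≡2*+1 (suc (suc n)) 2∤2+n with ¬2∣⇒≡2*+1 n (2∤2+n ∘ ∣m∣n⇒∣m+n ∣-refl)
... | e , refl = suc e , 2+[2e+1]≡2[1+e]+1 e
  where
  2+[2e+1]≡2[1+e]+1 : ∀ e → 2 + (2 * e + 1) ≡ 2 * suc e + 1
  2+[2e+1]≡2[1+e]+1 = solve-∀

oddPrimePowerSplit : ∀ {n} → ¬ 2 ∣ n → 1 < n → ∃[ e ] ∃[ a ] ∃[ r ]
  Prime (2 * e + 1) × ¬ 2 * e + 1 ∣ r × n ≡ (2 * e + 1) ^ suc a * r × φ n ≡ (2 * e + 1) ^ a * (2 * e) * φ r
oddPrimePowerSplit 2∤n 1<n with primePowerSplit 1<n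
... | p , a , r , p-prime , p∤r , refl
    with ¬2∣⇒≡2*+1 p (λ 2∣p → 2∤n (∣-trans 2∣p (∣m⇒∣m*n r (m∣m*n (p ^ a)))))
...   | e , refl = e , a , r , p-prime , p∤r , refl ,
  trans (φ-prime-power a p-prime p∤r) (cong (λ x → (2 * e + 1) ^ a * x * φ r) (m+n∸n≡m (2 * e) 1))

φ-even : ∀ {n} → ¬ 2 ∣ n → 1 < n → 2 ∣ φ n
φ-even 2∤n 1<n with oddPrimePowerSplit 2∤n 1<n
... | e , a , r , _ , _ , _ , φn≡ =
  subst (2 ∣_) (sym φn≡) (∣m⇒∣m*n (φ r) (∣n⇒∣m*n ((2 * e + 1) ^ a) (m∣m*n e)))

TwoPrimeForm : ℕ → ℕ → Set
TwoPrimeForm m u = Σ ℕ λ z₁ → Σ ℕ λ z₂ →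
  1 ≤ z₁ × 1 ≤ z₂ × z₁ ≢ z₂ × (z₁ * z₂) ∣ m ×
  Prime (2 * z₁ + 1) × Prime (2 * z₂ + 1) ×
  z₁ * z₂ * u ≡ (2 * z₁ + 1) * (2 * z₂ + 1) * m

OnePrimeForm : ℕ → ℕ → Set
OnePrimeForm m u = Σ ℕ λ z₃ → 1 ≤ z₃ × z₃ ∣ m × Prime (4 * z₃ + 1) × z₃ * u ≡ (4 * z₃ + 1) * m

Classification : ℕ → ℕ → Set
Classification m u = (TwoPrimeForm m u ⊎ OnePrimeForm m u) × (4 * m < u × u ≤ 7 * m)

4*z+1≤7*z : ∀ {z} → 1 ≤ z → 4 * z + 1 ≤ 7 * z
4*z+1≤7*z {suc z} _ = ≤‴⇒≤ (m≤‴m+k (gap z))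
  where
  gap : ∀ z → 4 * suc z + 1 + (3 * z + 2) ≡ 7 * suc z
  gap = solve-∀

4ef<[2e+1][2f+1] : ∀ e f → 4 * (e * f) < (2 * e + 1) * (2 * f + 1)
4ef<[2e+1][2f+1] e f = ≤‴⇒≤ (m≤‴m+k (gap e f))
  where
  gap : ∀ e f → suc (4 * (e * f)) + (2 * e + 2 * f) ≡ (2 * e + 1) * (2 * f + 1)
  gap = solve-∀

-- (2 + 1/e)(2 + 1/f) is largest for {e, f} = {1, 3}, where it equals 7.
[2e+1][2f+1]≤7ef : ∀ {e f} → ¬ 2 ∣ e → ¬ 2 ∣ f → e ≢ f → (2 * e + 1) * (2 * f + 1) ≤ 7 * (e * f)
[2e+1][2f+1]≤7ef {e} {f} 2∤e 2∤f e≢f with ¬2∣⇒≡2*+1 e 2∤e | ¬2∣⇒≡2*+1 f 2∤f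
... | x , refl | y , refl = bound x y (e≢f ∘ cong (λ t → 2 * t + 1))
  where
  gap₁ : ∀ y → 3 * (2 * (2 * suc y + 1) + 1) + 2 * y ≡ 7 * (1 * (2 * suc y + 1))
  gap₁ = solve-∀
  gap₂ : ∀ x y → (2 * (2 * suc x + 1) + 1) * (2 * (2 * y + 1) + 1) + (12 * x * y + 2 * x + 14 * y)
                 ≡ 7 * ((2 * suc x + 1) * (2 * y + 1))
  gap₂ = solve-∀
  bound : ∀ x y → x ≢ y → (2 * (2 * x + 1) + 1) * (2 * (2 * y + 1) + 1) ≤ 7 * ((2 * x + 1) * (2 * y + 1))
  bound zero    zero    0≢0 = ⊥-elim (0≢0 refl)
  bound zero    (suc y) _   = ≤‴⇒≤ (m≤‴m+k (gap₁ y))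
  bound (suc x) y       _   = ≤‴⇒≤ (m≤‴m+k (gap₂ x y))

onePrimeForm : ∀ {m u z P} → ¬ 2 ∣ m → Prime (4 * z + 1) → m ≡ z * P → u ≡ (4 * z + 1) * P → Classification m u
onePrimeForm {z = zero}            2∤m _ refl refl = ⊥-elim (2∤m (2 ∣0))
onePrimeForm {z = suc z} {P = zero} 2∤m _ refl refl = ⊥-elim (2∤m (subst (2 ∣_) (sym (*-zeroʳ (suc z))) (2 ∣0)))
onePrimeForm {z = z@(suc _)} {P = P@(suc _)} _ p-prime refl refl =
  inj₂ (z , s≤s z≤n , m∣m*n P , p-prime , x∙yz≈y∙xz z (4 * z + 1) P) , lower , upper
  where
  open ≤-Reasoning
  lower : 4 * (z * P) < (4 * z + 1) * P
  lower = begin-strict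
    4 * (z * P)     ≡⟨ sym (*-assoc 4 z P) ⟩
    4 * z * P       <⟨ *-monoˡ-< P (m<m+n (4 * z) z<s) ⟩
    (4 * z + 1) * P ∎
  upper : (4 * z + 1) * P ≤ 7 * (z * P)
  upper = begin
    (4 * z + 1) * P ≤⟨ *-monoˡ-≤ P (4*z+1≤7*z {z} (s≤s z≤n)) ⟩
    7 * z * P       ≡⟨ *-assoc 7 z P ⟩
    7 * (z * P)     ∎

twoPrimeForm : ∀ {m u e f K} → ¬ 2 ∣ m → Prime (2 * e + 1) → Prime (2 * f + 1) → e ≢ f →
  m ≡ e * f * K → u ≡ (2 * e + 1) * (2 * f + 1) * K → Classification m u
twoPrimeForm {e = e} {f} {K} 2∤m p-prime q-prime e≢f refl refl =
  inj₁ (e , f , positive 2∤e , positive 2∤f , e≢f , m∣m*n K , p-prime , q-prime ,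
        x∙yz≈y∙xz (e * f) ((2 * e + 1) * (2 * f + 1)) K) ,
  lower , upper
  where
  open ≤-Reasoning
  positive : ∀ {n} → ¬ 2 ∣ n → 1 ≤ n
  positive {zero}  2∤0 = ⊥-elim (2∤0 (2 ∣0))
  positive {suc _} _   = s≤s z≤n
  2∤e : ¬ 2 ∣ e
  2∤e 2∣e = 2∤m (∣m⇒∣m*n K (∣m⇒∣m*n f 2∣e))
  2∤f : ¬ 2 ∣ f
  2∤f 2∣f = 2∤m (∣m⇒∣m*n K (∣n⇒∣m*n e 2∣f))
  instance
    K≢0 : NonZero K
    K≢0 = >-nonZero (positive (2∤m ∘ ∣n⇒∣m*n (e * f)))
  lower : 4 * (e * f * K) < (2 * e + 1) * (2 * f + 1) * K
  lower = begin-strict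
    4 * (e * f * K)             ≡⟨ sym (*-assoc 4 (e * f) K) ⟩
    4 * (e * f) * K             <⟨ *-monoˡ-< K (4ef<[2e+1][2f+1] e f) ⟩
    (2 * e + 1) * (2 * f + 1) * K ∎
  upper : (2 * e + 1) * (2 * f + 1) * K ≤ 7 * (e * f * K)
  upper = begin
    (2 * e + 1) * (2 * f + 1) * K ≤⟨ *-monoˡ-≤ K ([2e+1][2f+1]≤7ef 2∤e 2∤f e≢f) ⟩
    7 * (e * f) * K               ≡⟨ *-assoc 7 (e * f) K ⟩
    7 * (e * f * K)               ∎

primePowerCase : ∀ {m e P} → ¬ 2 ∣ m → ¬ 2 ∣ P → Prime (2 * e + 1) →
  4 * m ≡ P * (2 * e) * 1 → Classification m ((2 * e + 1) * P * 1)
primePowerCase {m} {e} {P} 2∤m 2∤P p-prime 4m≡ with euclidsLemma P e prime[2] (divides m Pe≡m*2)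
  where
  identity₁ : ∀ P e → 2 * (P * e) ≡ P * (2 * e) * 1
  identity₁ = solve-∀
  identity₂ : ∀ m → 4 * m ≡ 2 * (m * 2)
  identity₂ = solve-∀
  Pe≡m*2 : P * e ≡ m * 2
  Pe≡m*2 = *-cancelˡ-≡ (P * e) (m * 2) 2 (trans (identity₁ P e) (trans (sym 4m≡) (identity₂ m)))
... | inj₁ 2∣P = ⊥-elim (2∤P 2∣P)
... | inj₂ (divides z refl) =
  onePrimeForm {z = z} {P} 2∤m (subst Prime (p≡ z) p-prime)
    (*-cancelˡ-≡ m (z * P) 4 (trans 4m≡ (m≡ z P))) (u≡ z P)
  where
  p≡ : ∀ z → 2 * (z * 2) + 1 ≡ 4 * z + 1
  p≡ = solve-∀
  m≡ : ∀ z P → P * (2 * (z * 2)) * 1 ≡ 4 * (z * P)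
  m≡ = solve-∀
  u≡ : ∀ z P → (2 * (z * 2) + 1) * P * 1 ≡ (4 * z + 1) * P
  u≡ = solve-∀

quarter : ∀ m e f P Q {r F} → r ≡ Q * (2 * f) * F → 4 * m ≡ P * (2 * e) * r → m ≡ e * f * (P * Q) * F
quarter m e f P Q {F = F} refl 4m≡ = *-cancelˡ-≡ m _ 4 (trans 4m≡ (identity e f P Q F))
  where
  identity : ∀ e f P Q F → P * (2 * e) * (Q * (2 * f) * F) ≡ 4 * (e * f * (P * Q) * F)
  identity = solve-∀

twoPrimePowersCase : ∀ {m e P r} → ¬ 2 ∣ m → ¬ 2 ∣ r → 1 < r → Prime (2 * e + 1) → ¬ 2 * e + 1 ∣ r →
  4 * m ≡ P * (2 * e) * φ r → Classification m ((2 * e + 1) * P * r)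
twoPrimePowersCase {m} {e} {P} 2∤m 2∤r 1<r p-prime p∤r 4m≡ with oddPrimePowerSplit 2∤r 1<r
... | f , b , zero , _ , _ , refl , _ = ⊥-elim (2∤r (subst (2 ∣_) (sym (*-zeroʳ ((2 * f + 1) ^ suc b))) (2 ∣0)))
... | f , b , 1 , q-prime , _ , refl , φr≡ =
  twoPrimeForm {K = P * Q} 2∤m p-prime q-prime e≢f (trans (quarter m e f P Q φr≡ 4m≡) (*-identityʳ _)) (u≡ e f P Q)
  where
  Q = (2 * f + 1) ^ b
  e≢f : e ≢ f
  e≢f refl = p∤r (∣m⇒∣m*n 1 (m∣m*n Q))
  u≡ : ∀ e f P Q → (2 * e + 1) * P * ((2 * f + 1) * Q * 1) ≡ (2 * e + 1) * (2 * f + 1) * (P * Q)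
  u≡ = solve-∀
... | f , b , 2+ s , _ , _ , refl , φr≡ = ⊥-elim (2∤m 2∣m)
  where
  2∤s : ¬ 2 ∣ 2+ s
  2∤s = 2∤r ∘ ∣n⇒∣m*n ((2 * f + 1) ^ suc b)
  2∣m : 2 ∣ m
  2∣m = subst (2 ∣_) (sym (quarter m e f P ((2 * f + 1) ^ b) φr≡ 4m≡))
              (∣n⇒∣m*n (e * f * (P * (2 * f + 1) ^ b)) (φ-even 2∤s (s<s z<s)))

classify : ∀ {m u} → ¬ 2 ∣ m → ¬ 2 ∣ u → 1 < u → φ u ≡ 4 * m → Classification m u
classify 2∤m 2∤u 1<u φu≡4m with oddPrimePowerSplit 2∤u 1<u
... | e , a , zero , _ , _ , refl , _ =
  ⊥-elim (2∤u (subst (2 ∣_) (sym (*-zeroʳ ((2 * e + 1) ^ suc a))) (2 ∣0)))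
... | e , a , 1 , p-prime , _ , refl , φu≡ =
  primePowerCase {e = e} {P = (2 * e + 1) ^ a} 2∤m (2∤u ∘ ∣m⇒∣m*n 1 ∘ ∣n⇒∣m*n (2 * e + 1)) p-prime
    (trans (sym φu≡4m) φu≡)
... | e , a , 2+ r , p-prime , p∤r , refl , φu≡ =
  twoPrimePowersCase {e = e} {P = (2 * e + 1) ^ a} 2∤m (2∤u ∘ ∣n⇒∣m*n ((2 * e + 1) ^ suc a)) (s<s z<s) p-prime p∤r
    (trans (sym φu≡4m) φu≡)

lemma3p19 : (m u : ℕ) → Odd m → Odd u → φ u ≡ 4 * m →
    ((Σ ℕ λ z₁ → Σ ℕ λ z₂ →
        1 ≤ z₁ × 1 ≤ z₂ × z₁ ≢ z₂ × (z₁ * z₂) ∣ m ×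
        Prime (2 * z₁ + 1) × Prime (2 * z₂ + 1) ×
        z₁ * z₂ * u ≡ (2 * z₁ + 1) * (2 * z₂ + 1) * m)
     ⊎
     (Σ ℕ λ z₃ →
        1 ≤ z₃ × z₃ ∣ m × Prime (4 * z₃ + 1) ×
        z₃ * u ≡ (4 * z₃ + 1) * m))
    × (4 * m < u × u ≤ 7 * m)
lemma3p19 m zero     _     ()    _
lemma3p19 m 1        _     _     φ1≡4m =
  ⊥-elim (odd⇒¬2∣ {1} refl (subst (2 ∣_) (sym φ1≡4m) (∣m⇒∣m*n m (divides 2 refl))))
lemma3p19 m (2+ u)   odd-m odd-u φu≡4m = classify (odd⇒¬2∣ odd-m) (odd⇒¬2∣ odd-u) (s<s z<s) φu≡4m
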